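{- Let $P,Q\in\mathbb{Z}[X]$ be non-constant polynomials whose gcd in $\mathbb{Z}[X]$ is trivial, and let $N\ge2$ be an integer. If $P\bmod N$ and $Q\bmod N$ are both multiples of the same monic polynomial $A\bmod N$ of degree $d\ge1$, then the resultant of $P$ and $Q$ is divisible by $N^d$. -}

module Defs where

open import Data.Nat as ℕ using (ℕ; zero; suc; _≤_; _<_; _∸_; _≤ᵇ_)
open import Data.Integer as ℤ using (ℤ; +_; -_; _+_; _*_; _-_)
open import Data.Integer.Divisibility as ℤD using ()
open import Data.Fin using (Fin; zero; suc; toℕ; punchIn; _↑ˡ_; _↑ʳ_; splitAt)
open import Data.Bool using (if_then_else_; _∧_)
open import Data.Sum using (_⊎_; inj₁; inj₂)
open import Data.Product using (Σ; ∃; _×_)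
open import Relation.Binary.PropositionalEquality using (_≡_; _≢_)

-- A polynomial in ℤ[X] is given by its coefficient function ℕ → ℤ
-- (coefficient of X^k), required to have finite support (IsPoly).
Poly : Set
Poly = ℕ → ℤ

IsPoly : Poly → Set
IsPoly f = ∃ λ n → ∀ k → n < k → f k ≡ + 0

HasDegree : Poly → ℕ → Set
HasDegree f n = (f n ≢ + 0) × (∀ k → n < k → f k ≡ + 0)

constP : ℤ → Poly
constP c zero    = c
constP c (suc k) = + 0

sumTo : ℕ → (ℕ → ℤ) → ℤ
sumTo zero    f = f 0
sumTo (suc k) f = sumTo k f + f (suc k)

_*P_ : Poly → Poly → Poly
(A *P B) k = sumTo k (λ i → A i * B (k ∸ i))

_∣P_ : Poly → Poly → Set
D ∣P P = Σ Poly λ R → IsPoly R × (∀ k → P k ≡ (D *P R) k)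

CoprimeP : Poly → Poly → Set
CoprimeP P Q = ∀ D → IsPoly D → D ∣P P → D ∣P Q →
  (∀ k → D k ≡ constP (+ 1) k) ⊎ (∀ k → D k ≡ constP (- + 1) k)

Monic : Poly → ℕ → Set
Monic A d = (A d ≡ + 1) × (∀ k → d < k → A k ≡ + 0)

DividesModN : ℕ → Poly → Poly → Set
DividesModN N A P = Σ Poly λ R → IsPoly R × (∀ k → (+ N) ℤD.∣ (P k - (A *P R) k))

sumFin : ∀ n → (Fin n → ℤ) → ℤ
sumFin zero    f = + 0
sumFin (suc n) f = f zero + sumFin n (λ j → f (suc j))

sign : ℕ → ℤ
sign zero          = + 1
sign (suc zero)    = - + 1
sign (suc (suc k)) = sign k

det : ∀ n → (Fin n → Fin n → ℤ) → ℤ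
det zero    M = + 1
det (suc n) M = sumFin (suc n) λ j →
  sign (toℕ j) * (M zero j * det n (λ r c → M (suc r) (punchIn j c)))

band : Poly → ℕ → ℕ → ℕ → ℤ
band f deg i j = if (i ≤ᵇ j) ∧ (j ≤ᵇ i ℕ.+ deg) then f (deg ℕ.+ i ∸ j) else + 0

-- Sylvester matrix of P (degree m) and Q (degree n): size (n+m) × (n+m);
-- the first n rows are shifted copies of P's coefficients, the last m rows
-- shifted copies of Q's coefficients (leading coefficients first).
sylvester : Poly → Poly → (m n : ℕ) → Fin (n ℕ.+ m) → Fin (n ℕ.+ m) → ℤ
sylvester P Q m n r c with splitAt n r
... | inj₁ i = band P m (toℕ i) (toℕ c)
... | inj₂ i = band Q n (toℕ i) (toℕ c)

resultant : Poly → Poly → (m n : ℕ) → ℤ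
resultant P Q m n = det (n ℕ.+ m) (sylvester P Q m n)

-- Modulo N, pairing a polynomial f with the sequence ρₜ(e) = (coefficient of X^t in X^e mod A),
-- i.e. f ↦ ∑ₑ fₑ ρₜ(e), kills every multiple of the monic A, because ρₜ satisfies the linear
-- recurrence whose characteristic polynomial is A. Column c of the Sylvester matrix holds the
-- coefficients of X^(n+m-1-c) in the rows X^i P and X^j Q, all multiples of A modulo N. Replacing
-- the column of X^t, for each t < d, by the combination of all columns with weights ρₜ is a
-- unitriangular column operation (ρₜ(e) = δₜₑ for e < d), so it keeps the determinant, and it
-- makes these d columns divisible by N; hence N^d divides the resultant. Finally d ≤ n + m:
-- otherwise the same pairing shows that N divides every coefficient of P and Q, so that the
-- non-unit N would be a common factor.
module Submission where

open import Defs
open import Data.Nat using (ℕ; _≤_; _^_)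
open import Data.Integer using (+_)
open import Data.Integer.Divisibility using (_∣_)

open import Data.Nat as ℕ using (zero; suc; pred; _<_; _∸_; _≟_; _≤?_; _<?_; z≤n; s≤s; z<s; s<s; s≤s⁻¹; s<s⁻¹; >-nonZero)
import Data.Nat.Properties as ℕP
import Data.Nat.Tactic.RingSolver as ℕSolver
open import Data.Integer as ℤ using (ℤ; -_; _+_; _*_; _-_; 0ℤ; 1ℤ)
import Data.Integer.Properties as ℤP
open import Data.Integer.Divisibility.Signed using (divides; quotient; ∣ᵤ⇒∣; ∣⇒∣ᵤ; ∣m∣n⇒∣m+n; ∣m⇒∣m*n; *-monoʳ-∣)
  renaming (_∣_ to _∣ˢ_)
open import Data.Integer.Tactic.RingSolver using (solve-∀)
open import Algebra.Properties.CommutativeSemigroup ℤP.+-commutativeSemigroup using (interchange; x∙yz≈y∙xz)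
open import Data.Fin as Fin using (Fin; toℕ; punchIn; splitAt)
import Data.Fin.Properties as FinP
open import Data.Bool using (true; false; T)
open import Data.Unit using (tt)
open import Data.Product using (_,_; proj₁; proj₂)
open import Data.Sum using (_⊎_; inj₁; inj₂)
open import Data.Empty using (⊥; ⊥-elim)
open import Relation.Binary.Definitions using (tri<; tri≈; tri>)
open import Relation.Nullary using (Dec; yes; no)
open import Relation.Binary.PropositionalEquality
open import Function using (_∘′_)

-- Finite sums

∑ : ℕ → (ℕ → ℤ) → ℤ
∑ zero    f = 0ℤ
∑ (suc n) f = f 0 + ∑ n (λ j → f (suc j))

∑-cong : ∀ n {f g : ℕ → ℤ} → (∀ j → j < n → f j ≡ g j) → ∑ n f ≡ ∑ n g
∑-cong zero    f≡g = refl
∑-cong (suc n) f≡g = cong₂ _+_ (f≡g 0 z<s) (∑-cong n (λ j j<n → f≡g (suc j) (s<s j<n)))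

∑-zero : ∀ n {f : ℕ → ℤ} → (∀ j → j < n → f j ≡ 0ℤ) → ∑ n f ≡ 0ℤ
∑-zero zero    f≡0 = refl
∑-zero (suc n) f≡0 = cong₂ _+_ (f≡0 0 z<s) (∑-zero n (λ j j<n → f≡0 (suc j) (s<s j<n)))

∑-+ : ∀ n (f g : ℕ → ℤ) → ∑ n (λ j → f j + g j) ≡ ∑ n f + ∑ n g
∑-+ zero    f g = refl
∑-+ (suc n) f g = trans (cong (_+_ (f 0 + g 0)) (∑-+ n _ _)) (interchange (f 0) (g 0) _ _)

∑-*ˡ : ∀ n c (f : ℕ → ℤ) → ∑ n (λ j → c * f j) ≡ c * ∑ n f
∑-*ˡ zero    c f = sym (ℤP.*-zeroʳ c)
∑-*ˡ (suc n) c f = trans (cong (_+_ (c * f 0)) (∑-*ˡ n c _)) (sym (ℤP.*-distribˡ-+ c (f 0) _))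

∑-neg : ∀ n (f : ℕ → ℤ) → ∑ n (λ j → - f j) ≡ - ∑ n f
∑-neg zero    f = refl
∑-neg (suc n) f = trans (cong (_+_ (- f 0)) (∑-neg n _)) (sym (ℤP.neg-distrib-+ (f 0) _))

∑-last : ∀ n f → ∑ (suc n) f ≡ ∑ n f + f n
∑-last zero    f = ℤP.+-comm (f 0) 0ℤ
∑-last (suc n) f = trans (cong (_+_ (f 0)) (∑-last n _)) (sym (ℤP.+-assoc (f 0) _ _))

∑-split : ∀ a b f → ∑ (a ℕ.+ b) f ≡ ∑ a f + ∑ b (λ j → f (a ℕ.+ j))
∑-split zero    b f = sym (ℤP.+-identityˡ _)
∑-split (suc a) b f = trans (cong (_+_ (f 0)) (∑-split a b _)) (sym (ℤP.+-assoc (f 0) _ _))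

∑-extend : ∀ B k f → (∀ e → B ≤ e → f e ≡ 0ℤ) → ∑ (B ℕ.+ k) f ≡ ∑ B f
∑-extend B k f f-vanishes = begin
  ∑ (B ℕ.+ k) f                       ≡⟨ ∑-split B k f ⟩
  ∑ B f + ∑ k (λ j → f (B ℕ.+ j))     ≡⟨ cong (_+_ (∑ B f)) (∑-zero k (λ j _ → f-vanishes (B ℕ.+ j) (ℕP.m≤m+n B j))) ⟩
  ∑ B f + 0ℤ                          ≡⟨ ℤP.+-identityʳ _ ⟩
  ∑ B f                               ∎
  where open ≡-Reasoning

∑-reverse : ∀ n g → ∑ n (λ c → g (n ∸ suc c)) ≡ ∑ n g
∑-reverse zero    g = refl
∑-reverse (suc n) g = begin
  g n + ∑ n (λ c → g (n ∸ suc c)) ≡⟨ cong (_+_ (g n)) (∑-reverse n g) ⟩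
  g n + ∑ n g                     ≡⟨ ℤP.+-comm (g n) (∑ n g) ⟩
  ∑ n g + g n                     ≡⟨ ∑-last n g ⟨
  ∑ (suc n) g                     ∎
  where open ≡-Reasoning

∑-select : ∀ n j g → j < n → (∀ c → c < n → c ≢ j → g c ≡ 0ℤ) → ∑ n g ≡ g j
∑-select (suc n) zero g _ others≡0 =
  trans (cong (_+_ (g 0)) (∑-zero n (λ c c<n → others≡0 (suc c) (s<s c<n) (λ ())))) (ℤP.+-identityʳ _)
∑-select (suc n) (suc j) g (s<s j<n) others≡0 =
  trans (cong₂ _+_ (others≡0 0 z<s (λ ()))
                   (∑-select n j _ j<n (λ c c<n c≢j → others≡0 (suc c) (s<s c<n) (c≢j ∘′ ℕP.suc-injective))))
        (ℤP.+-identityˡ _)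

∣⇒∣∑ : ∀ {x} n f → (∀ j → j < n → x ∣ˢ f j) → x ∣ˢ ∑ n f
∣⇒∣∑ zero    f _   = divides 0ℤ refl
∣⇒∣∑ (suc n) f x∣f = ∣m∣n⇒∣m+n (x∣f 0 z<s) (∣⇒∣∑ n _ (λ j j<n → x∣f (suc j) (s<s j<n)))

-- Determinants of ℕ-indexed matrices

Mat : Set
Mat = ℕ → ℕ → ℤ

punchInℕ : ℕ → ℕ → ℕ
punchInℕ zero    c       = suc c
punchInℕ (suc j) zero    = zero
punchInℕ (suc j) (suc c) = suc (punchInℕ j c)

punchOutℕ : ℕ → ℕ → ℕ
punchOutℕ zero    zero    = zero
punchOutℕ zero    (suc c) = c
punchOutℕ (suc j) zero    = zero
punchOutℕ (suc j) (suc c) = suc (punchOutℕ j c)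

punchInℕ-≤ : ∀ j c → punchInℕ j c ≤ suc c
punchInℕ-≤ zero    c       = ℕP.≤-refl
punchInℕ-≤ (suc j) zero    = z≤n
punchInℕ-≤ (suc j) (suc c) = s≤s (punchInℕ-≤ j c)

punchInℕ-< : ∀ j {c n} → c < n → punchInℕ j c < suc n
punchInℕ-< j {c} c<n = ℕP.≤-<-trans (punchInℕ-≤ j c) (s<s c<n)

punchInℕ-≢ : ∀ j c → punchInℕ j c ≢ j
punchInℕ-≢ (suc j) (suc c) eq = punchInℕ-≢ j c (ℕP.suc-injective eq)

punchInℕ-punchOutℕ : ∀ j c → j ≢ c → punchInℕ j (punchOutℕ j c) ≡ c
punchInℕ-punchOutℕ zero    zero    j≢c = ⊥-elim (j≢c refl)
punchInℕ-punchOutℕ zero    (suc c) j≢c = refl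
punchInℕ-punchOutℕ (suc j) zero    j≢c = refl
punchInℕ-punchOutℕ (suc j) (suc c) j≢c = cong suc (punchInℕ-punchOutℕ j c (j≢c ∘′ cong suc))

punchOutℕ-punchInℕ : ∀ j c → punchOutℕ j (punchInℕ j c) ≡ c
punchOutℕ-punchInℕ zero    c       = refl
punchOutℕ-punchInℕ (suc j) zero    = refl
punchOutℕ-punchInℕ (suc j) (suc c) = cong suc (punchOutℕ-punchInℕ j c)

punchOutℕ-< : ∀ n j c → j ≢ c → j < suc n → c < suc n → punchOutℕ j c < n
punchOutℕ-< n       zero    zero    j≢c _         _         = ⊥-elim (j≢c refl)
punchOutℕ-< n       zero    (suc c) _   _         (s<s c<n) = c<n
punchOutℕ-< zero    (suc j) zero    _   (s<s ())  _
punchOutℕ-< (suc n) (suc j) zero    _   _         _         = z<s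
punchOutℕ-< (suc n) (suc j) (suc c) j≢c (s<s j<n) (s<s c<n) = s<s (punchOutℕ-< n j c (j≢c ∘′ cong suc) j<n c<n)

minor : ℕ → Mat → Mat
minor j M r c = M (suc r) (punchInℕ j c)

detN : ℕ → Mat → ℤ
detN zero    M = 1ℤ
detN (suc n) M = ∑ (suc n) (λ j → sign j * (M 0 j * detN n (minor j M)))

laplaceTerm : ℕ → Mat → ℕ → ℤ
laplaceTerm n M j = sign j * (M 0 j * detN n (minor j M))

detN-cong : ∀ n {M M′ : Mat} → (∀ r c → r < n → c < n → M r c ≡ M′ r c) → detN n M ≡ detN n M′
detN-cong zero    M≡M′ = refl
detN-cong (suc n) M≡M′ = ∑-cong (suc n) λ j j<n →
  cong₂ (λ a D → sign j * (a * D)) (M≡M′ 0 j z<s j<n)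
        (detN-cong n (λ r c r<n c<n → M≡M′ (suc r) (punchInℕ j c) (s<s r<n) (punchInℕ-< j c<n)))

sumFin≡∑ : ∀ n (f : Fin n → ℤ) (g : ℕ → ℤ) → (∀ j → f j ≡ g (toℕ j)) → sumFin n f ≡ ∑ n g
sumFin≡∑ zero    f g f≡g = refl
sumFin≡∑ (suc n) f g f≡g = cong₂ _+_ (f≡g Fin.zero) (sumFin≡∑ n _ _ (λ j → f≡g (Fin.suc j)))

toℕ-punchIn : ∀ {n} (j : Fin (suc n)) (c : Fin n) → toℕ (punchIn j c) ≡ punchInℕ (toℕ j) (toℕ c)
toℕ-punchIn Fin.zero    c           = refl
toℕ-punchIn (Fin.suc j) Fin.zero    = refl
toℕ-punchIn (Fin.suc j) (Fin.suc c) = cong suc (toℕ-punchIn j c)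

det≡detN : ∀ n (M : Fin n → Fin n → ℤ) (M′ : Mat) → (∀ r c → M r c ≡ M′ (toℕ r) (toℕ c)) → det n M ≡ detN n M′
det≡detN zero    M M′ M≡M′ = refl
det≡detN (suc n) M M′ M≡M′ = sumFin≡∑ (suc n) _ (laplaceTerm n M′) λ j →
  cong₂ (λ a D → sign (toℕ j) * (a * D)) (M≡M′ Fin.zero j)
        (det≡detN n _ (minor (toℕ j) M′)
          (λ r c → trans (M≡M′ (Fin.suc r) (punchIn j c)) (cong (M′ (suc (toℕ r))) (toℕ-punchIn j c))))

sign-suc : ∀ k → sign (suc k) ≡ - sign k
sign-suc zero          = refl
sign-suc (suc zero)    = refl
sign-suc (suc (suc k)) = sign-suc k

-- Column operations

setColumn : ℕ → (ℕ → ℤ) → Mat → Mat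
setColumn j u M r c with c ≟ j
... | yes _ = u r
... | no  _ = M r c

setColumn-same : ∀ j u M r → setColumn j u M r j ≡ u r
setColumn-same j u M r with j ≟ j
... | yes _   = refl
... | no  j≢j = ⊥-elim (j≢j refl)

setColumn-other : ∀ j u M r {c} → c ≢ j → setColumn j u M r c ≡ M r c
setColumn-other j u M r {c} c≢j with c ≟ j
... | yes c≡j = ⊥-elim (c≢j c≡j)
... | no  _   = refl

setColumn-self : ∀ j M r c → setColumn j (λ r → M r j) M r c ≡ M r c
setColumn-self j M r c with c ≟ j
... | yes refl = refl
... | no  _    = refl

minor-setColumn-same : ∀ j u M r c → minor j (setColumn j u M) r c ≡ minor j M r c
minor-setColumn-same j u M r c = setColumn-other j u M (suc r) (punchInℕ-≢ j c)

minor-setColumn-other : ∀ i j u M → i ≢ j → ∀ r c →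
  minor i (setColumn j u M) r c ≡ setColumn (punchOutℕ i j) (λ r → u (suc r)) (minor i M) r c
minor-setColumn-other i j u M i≢j r c with punchInℕ i c ≟ j | c ≟ punchOutℕ i j
... | yes _  | yes _  = refl
... | no  _  | no  _  = refl
... | yes eq | no  ne = ⊥-elim (ne (trans (sym (punchOutℕ-punchInℕ i c)) (cong (punchOutℕ i) eq)))
... | no  ne | yes eq = ⊥-elim (ne (trans (cong (punchInℕ i) eq) (punchInℕ-punchOutℕ i j i≢j)))

laplaceTerm-setColumn-same : ∀ n j u M → laplaceTerm n (setColumn j u M) j ≡ sign j * (u 0 * detN n (minor j M))
laplaceTerm-setColumn-same n j u M = cong₂ (λ a D → sign j * (a * D)) (setColumn-same j u M 0)
  (detN-cong n (λ r c _ _ → minor-setColumn-same j u M r c))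

laplaceTerm-setColumn-other : ∀ n i j u M → i ≢ j → laplaceTerm n (setColumn j u M) i ≡
  sign i * (M 0 i * detN n (setColumn (punchOutℕ i j) (λ r → u (suc r)) (minor i M)))
laplaceTerm-setColumn-other n i j u M i≢j = cong₂ (λ a D → sign i * (a * D)) (setColumn-other j u M 0 i≢j)
  (detN-cong n (λ r c _ _ → minor-setColumn-other i j u M i≢j r c))

detN-linear : ∀ n M j (u v : ℕ → ℤ) x y → j < n →
  detN n (setColumn j (λ r → x * u r + y * v r) M) ≡ x * detN n (setColumn j u M) + y * detN n (setColumn j v M)
detN-linear (suc n) M j u v x y j<n = begin
  ∑ (suc n) (term w)                                              ≡⟨ ∑-cong (suc n) term-linear ⟩
  ∑ (suc n) (λ i → x * term u i + y * term v i)                   ≡⟨ ∑-+ (suc n) (λ i → x * term u i) (λ i → y * term v i) ⟩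
  ∑ (suc n) (λ i → x * term u i) + ∑ (suc n) (λ i → y * term v i)
    ≡⟨ cong₂ _+_ (∑-*ˡ (suc n) x (term u)) (∑-*ˡ (suc n) y (term v)) ⟩
  x * ∑ (suc n) (term u) + y * ∑ (suc n) (term v)                 ∎
  where
  open ≡-Reasoning
  w : ℕ → ℤ
  w r = x * u r + y * v r
  term : (ℕ → ℤ) → ℕ → ℤ
  term t = laplaceTerm n (setColumn j t M)
  linear-in-entry : ∀ x y s a b D → s * ((x * a + y * b) * D) ≡ x * (s * (a * D)) + y * (s * (b * D))
  linear-in-entry = solve-∀
  linear-in-minor : ∀ x y s a D E → s * (a * (x * D + y * E)) ≡ x * (s * (a * D)) + y * (s * (a * E))
  linear-in-minor = solve-∀
  term-linear : ∀ i → i < suc n → term w i ≡ x * term u i + y * term v i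
  term-linear i i<n = by-cases (i ≟ j)
    where
    tail : (ℕ → ℤ) → ℕ → ℤ
    tail t r = t (suc r)
    by-cases : Dec (i ≡ j) → term w i ≡ x * term u i + y * term v i
    by-cases (yes refl) = begin
      term w i                                  ≡⟨ laplaceTerm-setColumn-same n i w M ⟩
      sign i * (w 0 * D)                        ≡⟨ linear-in-entry x y (sign i) (u 0) (v 0) D ⟩
      x * (sign i * (u 0 * D)) + y * (sign i * (v 0 * D))
        ≡⟨ cong₂ (λ a b → x * a + y * b) (laplaceTerm-setColumn-same n i u M) (laplaceTerm-setColumn-same n i v M) ⟨
      x * term u i + y * term v i               ∎
      where D = detN n (minor i M)
    by-cases (no i≢j) = begin
      term w i                                  ≡⟨ laplaceTerm-setColumn-other n i j w M i≢j ⟩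
      sign i * (M 0 i * D w)                    ≡⟨ cong (λ E → sign i * (M 0 i * E))
                                                        (detN-linear n (minor i M) j′ (tail u) (tail v) x y (punchOutℕ-< n i j i≢j i<n j<n)) ⟩
      sign i * (M 0 i * (x * D u + y * D v))    ≡⟨ linear-in-minor x y (sign i) (M 0 i) (D u) (D v) ⟩
      x * (sign i * (M 0 i * D u)) + y * (sign i * (M 0 i * D v))
        ≡⟨ cong₂ (λ a b → x * a + y * b) (laplaceTerm-setColumn-other n i j u M i≢j) (laplaceTerm-setColumn-other n i j v M i≢j) ⟨
      x * term u i + y * term v i               ∎
      where
      j′ = punchOutℕ i j
      D : (ℕ → ℤ) → ℤ
      D t = detN n (setColumn j′ (tail t) (minor i M))

swap : ℕ → ℕ → ℕ
swap zero    zero          = 1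
swap zero    (suc zero)    = 0
swap zero    (suc (suc c)) = suc (suc c)
swap (suc k) zero          = zero
swap (suc k) (suc c)       = suc (swap k c)

swap-left : ∀ k → swap k k ≡ suc k
swap-left zero    = refl
swap-left (suc k) = cong suc (swap-left k)

swap-right : ∀ k → swap k (suc k) ≡ k
swap-right zero    = refl
swap-right (suc k) = cong suc (swap-right k)

swap-other : ∀ k c → c ≢ k → c ≢ suc k → swap k c ≡ c
swap-other zero    zero          c≢k _    = ⊥-elim (c≢k refl)
swap-other zero    (suc zero)    _   c≢sk = ⊥-elim (c≢sk refl)
swap-other zero    (suc (suc c)) _   _    = refl
swap-other (suc k) zero          _   _    = refl
swap-other (suc k) (suc c)       c≢k c≢sk = cong suc (swap-other k c (c≢k ∘′ cong suc) (c≢sk ∘′ cong suc))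

∑-swap : ∀ n k g → suc k < n → ∑ n (λ j → g (swap k j)) ≡ ∑ n g
∑-swap (suc (suc n)) zero    g _         = x∙yz≈y∙xz (g 1) (g 0) _
∑-swap (suc n)       (suc k) g (s<s k<n) = cong (_+_ (g 0)) (∑-swap n k (λ j → g (suc j)) k<n)

swap-punchInℕ-left : ∀ k c → swap k (punchInℕ k c) ≡ punchInℕ (suc k) c
swap-punchInℕ-left zero    zero    = refl
swap-punchInℕ-left zero    (suc c) = refl
swap-punchInℕ-left (suc k) zero    = refl
swap-punchInℕ-left (suc k) (suc c) = cong suc (swap-punchInℕ-left k c)

swap-punchInℕ-right : ∀ k c → swap k (punchInℕ (suc k) c) ≡ punchInℕ k c
swap-punchInℕ-right zero    zero    = refl
swap-punchInℕ-right zero    (suc c) = refl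
swap-punchInℕ-right (suc k) zero    = refl
swap-punchInℕ-right (suc k) (suc c) = cong suc (swap-punchInℕ-right k c)

swap-punchInℕ-above : ∀ k j c → suc k < j → swap k (punchInℕ j c) ≡ punchInℕ j (swap k c)
swap-punchInℕ-above zero    (suc zero)    c             (s<s ())
swap-punchInℕ-above zero    (suc (suc j)) zero          _         = refl
swap-punchInℕ-above zero    (suc (suc j)) (suc zero)    _         = refl
swap-punchInℕ-above zero    (suc (suc j)) (suc (suc c)) _         = refl
swap-punchInℕ-above (suc k) (suc j)       zero          _         = refl
swap-punchInℕ-above (suc k) (suc j)       (suc c)       (s<s k<j) = cong suc (swap-punchInℕ-above k j c k<j)

swap-punchInℕ-below : ∀ k j c → j < k → swap k (punchInℕ j c) ≡ punchInℕ j (swap (pred k) c)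
swap-punchInℕ-below (suc k)       zero    c       _         = refl
swap-punchInℕ-below (suc zero)    (suc j) c       (s<s ())
swap-punchInℕ-below (suc (suc k)) (suc j) zero    _         = refl
swap-punchInℕ-below (suc (suc k)) (suc j) (suc c) (s<s j<k) = cong suc (swap-punchInℕ-below (suc k) j c j<k)

laplaceTerm-swap-adjacent : ∀ n M k j i → swap k j ≡ i → sign i ≡ - sign j →
  (∀ c → swap k (punchInℕ j c) ≡ punchInℕ i c) →
  laplaceTerm n (λ r c → M r (swap k c)) j ≡ - laplaceTerm n M (swap k j)
laplaceTerm-swap-adjacent n M k j i swapped sign-flips moves = begin
  sign j * (M 0 (swap k j) * detN n (minor j M′))  ≡⟨ cong₂ (λ a D → sign j * (a * D)) (cong (M 0) swapped) minor-moves ⟩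
  sign j * (M 0 i * detN n (minor i M))            ≡⟨ flip-sign (sign j) (M 0 i) _ ⟩
  - (- sign j * (M 0 i * detN n (minor i M)))      ≡⟨ cong (λ s → - (s * (M 0 i * detN n (minor i M)))) sign-flips ⟨
  - laplaceTerm n M i                              ≡⟨ cong (λ i → - laplaceTerm n M i) swapped ⟨
  - laplaceTerm n M (swap k j)                     ∎
  where
  open ≡-Reasoning
  M′ : Mat
  M′ r c = M r (swap k c)
  flip-sign : ∀ s a D → s * (a * D) ≡ - (- s * (a * D))
  flip-sign = solve-∀
  minor-moves : detN n (minor j M′) ≡ detN n (minor i M)
  minor-moves = detN-cong n (λ r c _ _ → cong (M (suc r)) (moves c))

detN-swap : ∀ n M k → suc k < n → detN n (λ r c → M r (swap k c)) ≡ - detN n M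
detN-swap (suc n) M k sk<n = begin
  ∑ (suc n) (laplaceTerm n M′)                    ≡⟨ ∑-cong (suc n) term-swap ⟩
  ∑ (suc n) (λ j → - laplaceTerm n M (swap k j))  ≡⟨ ∑-neg (suc n) (λ j → laplaceTerm n M (swap k j)) ⟩
  - ∑ (suc n) (λ j → laplaceTerm n M (swap k j))  ≡⟨ cong -_ (∑-swap (suc n) k (laplaceTerm n M) sk<n) ⟩
  - ∑ (suc n) (laplaceTerm n M)                   ∎
  where
  open ≡-Reasoning
  M′ : Mat
  M′ r c = M r (swap k c)
  flip-minor : ∀ s a D → s * (a * - D) ≡ - (s * (a * D))
  flip-minor = solve-∀
  term-swap-fixed : ∀ j k′ → swap k j ≡ j → suc k′ < n →
    (∀ c → swap k (punchInℕ j c) ≡ punchInℕ j (swap k′ c)) → laplaceTerm n M′ j ≡ - laplaceTerm n M (swap k j)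
  term-swap-fixed j k′ fixed k′<n commutes = begin
    laplaceTerm n M′ j                         ≡⟨ cong₂ (λ a D → sign j * (a * D)) (cong (M 0) fixed) minor-swaps ⟩
    sign j * (M 0 j * - detN n (minor j M))    ≡⟨ flip-minor (sign j) (M 0 j) _ ⟩
    - laplaceTerm n M j                        ≡⟨ cong (λ i → - laplaceTerm n M i) fixed ⟨
    - laplaceTerm n M (swap k j)               ∎
    where
    minor-swaps : detN n (minor j M′) ≡ - detN n (minor j M)
    minor-swaps = trans (detN-cong n (λ r c _ _ → cong (M (suc r)) (commutes c))) (detN-swap n (minor j M) k′ k′<n)
  term-swap : ∀ j → j < suc n → laplaceTerm n M′ j ≡ - laplaceTerm n M (swap k j)
  term-swap j j<n with ℕP.<-cmp j k
  ... | tri≈ _ refl _ = laplaceTerm-swap-adjacent n M k j (suc j) (swap-left j) (sign-suc j) (swap-punchInℕ-left j)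
  ... | tri< j<k _ _ = term-swap-fixed j (pred k)
          (swap-other k j (ℕP.<⇒≢ j<k) (ℕP.<⇒≢ (ℕP.m<n⇒m<1+n j<k))) pred-k<n (λ c → swap-punchInℕ-below k j c j<k)
    where
    pred-k<n : suc (pred k) < n
    pred-k<n = subst (_< n) (sym (ℕP.suc-pred k {{>-nonZero (ℕP.≤-<-trans z≤n j<k)}})) (s<s⁻¹ sk<n)
  ... | tri> _ _ k<j with j ≟ suc k
  ...   | yes refl = laplaceTerm-swap-adjacent n M k (suc k) k (swap-right k)
                       (sym (trans (cong -_ (sign-suc k)) (ℤP.neg-involutive (sign k)))) (swap-punchInℕ-right k)
  ...   | no j≢sk  = term-swap-fixed j k (swap-other k j (ℕP.<⇒≢ k<j ∘′ sym) j≢sk) (ℕP.<-≤-trans sk<j (s≤s⁻¹ j<n))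
                       (λ c → swap-punchInℕ-above k j c sk<j)
    where
    sk<j : suc k < j
    sk<j = ℕP.≤∧≢⇒< k<j (j≢sk ∘′ sym)

i≡-i⇒i≡0 : ∀ i → i ≡ - i → i ≡ 0ℤ
i≡-i⇒i≡0 (+ zero) _ = refl

detN-adjacentEqual : ∀ n M k → suc k < n → (∀ r → M r k ≡ M r (suc k)) → detN n M ≡ 0ℤ
detN-adjacentEqual n M k sk<n same = i≡-i⇒i≡0 _ (trans (detN-cong n swap-invariant) (detN-swap n M k sk<n))
  where
  swap-invariant : ∀ r c → r < n → c < n → M r c ≡ M r (swap k c)
  swap-invariant r c _ _ with c ≟ k | c ≟ suc k
  ... | yes refl | _        = trans (same r) (cong (M r) (sym (swap-left c)))
  ... | no _     | yes refl = trans (sym (same r)) (cong (M r) (sym (swap-right k)))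
  ... | no c≢k   | no c≢sk  = cong (M r) (sym (swap-other k c c≢k c≢sk))

detN-equalColumns : ∀ n M {a} b → a < b → b < n → (∀ r → M r a ≡ M r b) → detN n M ≡ 0ℤ
detN-equalColumns n M {a} (suc b) a<sb sb<n same with a ≟ b
... | yes refl = detN-adjacentEqual n M a sb<n same
... | no a≢b = begin
  detN n M                             ≡⟨ ℤP.neg-involutive _ ⟨
  - - detN n M                         ≡⟨ cong -_ (detN-swap n M b sb<n) ⟨
  - detN n (λ r c → M r (swap b c))    ≡⟨ cong -_ (detN-equalColumns n _ b a<b (ℕP.<-trans (ℕP.n<1+n b) sb<n) same′) ⟩
  - 0ℤ                                 ∎
  where
  open ≡-Reasoning
  a<b : a < b
  a<b = ℕP.≤∧≢⇒< (s≤s⁻¹ a<sb) a≢b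
  same′ : ∀ r → M r (swap b a) ≡ M r (swap b b)
  same′ r = trans (cong (M r) (swap-other b a a≢b (ℕP.<⇒≢ a<sb)))
                  (trans (same r) (cong (M r) (sym (swap-left b))))

detN-setColumn-duplicate : ∀ n M j c → j < n → c < n → c ≢ j → detN n (setColumn j (λ r → M r c) M) ≡ 0ℤ
detN-setColumn-duplicate n M j c j<n c<n c≢j with ℕP.<-cmp j c
... | tri< j<c _ _ = detN-equalColumns n _ c j<c c<n
      (λ r → trans (setColumn-same j _ M r) (sym (setColumn-other j _ M r c≢j)))
... | tri≈ _ j≡c _ = ⊥-elim (c≢j (sym j≡c))
... | tri> _ _ c<j = detN-equalColumns n _ j c<j j<n
      (λ r → trans (setColumn-other j _ M r c≢j) (sym (setColumn-same j _ M r)))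

setColumn-cong : ∀ j {u v : ℕ → ℤ} M → (∀ r → u r ≡ v r) → ∀ r c → setColumn j u M r c ≡ setColumn j v M r c
setColumn-cong j M u≡v r c with c ≟ j
... | yes _ = u≡v r
... | no  _ = refl

detN-setColumn-∑ : ∀ n M j L (β : ℕ → ℤ) (u : ℕ → ℕ → ℤ) → j < n →
  detN n (setColumn j (λ r → ∑ L (λ c → β c * u c r)) M) ≡ ∑ L (λ c → β c * detN n (setColumn j (u c) M))
detN-setColumn-∑ n M j zero    β u j<n = detN-linear n M j (λ _ → 0ℤ) (λ _ → 0ℤ) 0ℤ 0ℤ j<n
detN-setColumn-∑ n M j (suc L) β u j<n = begin
  detN n (setColumn j (λ r → β 0 * u 0 r + rest r) M)
    ≡⟨ detN-cong n (λ r c _ _ → setColumn-cong j M (λ r → cong (_+_ (β 0 * u 0 r)) (ℤP.*-identityˡ (rest r))) r c) ⟨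
  detN n (setColumn j (λ r → β 0 * u 0 r + 1ℤ * rest r) M)
    ≡⟨ detN-linear n M j (u 0) rest (β 0) 1ℤ j<n ⟩
  β 0 * detN n (setColumn j (u 0) M) + 1ℤ * detN n (setColumn j rest M)
    ≡⟨ cong (_+_ (β 0 * detN n (setColumn j (u 0) M))) (ℤP.*-identityˡ _) ⟩
  β 0 * detN n (setColumn j (u 0) M) + detN n (setColumn j rest M)
    ≡⟨ cong (_+_ (β 0 * detN n (setColumn j (u 0) M))) (detN-setColumn-∑ n M j L (λ c → β (suc c)) (λ c → u (suc c)) j<n) ⟩
  ∑ (suc L) (λ c → β c * detN n (setColumn j (u c) M)) ∎
  where
  open ≡-Reasoning
  rest : ℕ → ℤ
  rest r = ∑ L (λ c → β (suc c) * u (suc c) r)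

detN-setColumn-combination : ∀ n M j (β : ℕ → ℤ) → j < n →
  detN n (setColumn j (λ r → ∑ n (λ c → β c * M r c)) M) ≡ β j * detN n M
detN-setColumn-combination n M j β j<n = begin
  detN n (setColumn j (λ r → ∑ n (λ c → β c * M r c)) M)
    ≡⟨ detN-setColumn-∑ n M j n β (λ c r → M r c) j<n ⟩
  ∑ n (λ c → β c * detN n (setColumn j (λ r → M r c) M))
    ≡⟨ ∑-select n j _ j<n (λ c c<n c≢j → trans (cong (β c *_) (detN-setColumn-duplicate n M j c j<n c<n c≢j)) (ℤP.*-zeroʳ (β c))) ⟩
  β j * detN n (setColumn j (λ r → M r j) M)
    ≡⟨ cong (β j *_) (detN-cong n (λ r c _ _ → setColumn-self j M r c)) ⟩
  β j * detN n M ∎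
  where open ≡-Reasoning

detN-factorColumn : ∀ n M j x (u : ℕ → ℤ) → j < n → (∀ r → r < n → M r j ≡ x * u r) →
  detN n M ≡ x * detN n (setColumn j u M)
detN-factorColumn n M j x u j<n column≡ =
  trans (detN-cong n M≡) (trans (detN-linear n M j u u x 0ℤ j<n) (ℤP.+-identityʳ _))
  where
  M≡ : ∀ r c → r < n → c < n → M r c ≡ setColumn j (λ r → x * u r + 0ℤ * u r) M r c
  M≡ r c r<n _ with c ≟ j
  ... | yes refl = trans (column≡ r r<n) (sym (ℤP.+-identityʳ _))
  ... | no  _    = refl

detN-trailingColumnsDivisible : ∀ n x d M → d ≤ n → (∀ r c → r < n → n ∸ d ≤ c → c < n → x ∣ˢ M r c) →
  (x ℤ.^ d) ∣ˢ detN n M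
detN-trailingColumnsDivisible n x zero    M _    _       = divides (detN n M) (sym (ℤP.*-identityʳ _))
detN-trailingColumnsDivisible n x (suc d) M sd≤n x∣M =
  subst (λ D → x ℤ.^ suc d ∣ˢ D) (sym (detN-factorColumn n M j x quotientColumn j<n column≡))
        (*-monoʳ-∣ x (detN-trailingColumnsDivisible n x d (setColumn j quotientColumn M) (ℕP.<⇒≤ sd≤n) x∣M′))
  where
  j : ℕ
  j = n ∸ suc d
  j<n : j < n
  j<n = ℕP.∸-monoʳ-< z<s sd≤n
  j<n∸d : j < n ∸ d
  j<n∸d = ℕP.∸-monoʳ-< (ℕP.n<1+n d) sd≤n
  quotientColumn : ℕ → ℤ
  quotientColumn r with r <? n
  ... | yes r<n = quotient (x∣M r j r<n ℕP.≤-refl j<n)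
  ... | no  _   = 0ℤ
  column≡ : ∀ r → r < n → M r j ≡ x * quotientColumn r
  column≡ r r<n with r <? n
  ... | yes r<n = trans (_∣ˢ_.equality (x∣M r j r<n ℕP.≤-refl j<n)) (ℤP.*-comm _ x)
  ... | no  r≮n = ⊥-elim (r≮n r<n)
  x∣M′ : ∀ r c → r < n → n ∸ d ≤ c → c < n → x ∣ˢ setColumn j quotientColumn M r c
  x∣M′ r c r<n n∸d≤c c<n = subst (x ∣ˢ_) (sym (setColumn-other j _ M r c≢j))
                                 (x∣M r c r<n (ℕP.≤-trans (ℕP.<⇒≤ j<n∸d) n∸d≤c) c<n)
    where
    c≢j : c ≢ j
    c≢j = ℕP.<⇒≢ (ℕP.<-≤-trans j<n∸d n∸d≤c) ∘′ sym

m<n⇒n∸m≡1+[n∸1+m] : ∀ {m n} → m < n → n ∸ m ≡ suc (n ∸ suc m)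
m<n⇒n∸m≡1+[n∸1+m] {zero}  {suc n} _         = refl
m<n⇒n∸m≡1+[n∸1+m] {suc m} {suc n} (s<s m<n) = m<n⇒n∸m≡1+[n∸1+m] m<n

combineTrailingColumns : ℕ → ℕ → (ℕ → ℕ → ℤ) → Mat → Mat
combineTrailingColumns n k β M r c with n ∸ k ≤? c
... | yes _ = ∑ n (λ c′ → β c c′ * M r c′)
... | no  _ = M r c

combineTrailingColumns-leading : ∀ n k β M r {c} → c < n ∸ k → combineTrailingColumns n k β M r c ≡ M r c
combineTrailingColumns-leading n k β M r {c} c<n∸k with n ∸ k ≤? c
... | yes n∸k≤c = ⊥-elim (ℕP.<⇒≱ c<n∸k n∸k≤c)
... | no  _     = refl

combineTrailingColumns-trailing : ∀ n k β M r {c} → n ∸ k ≤ c →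
  combineTrailingColumns n k β M r c ≡ ∑ n (λ c′ → β c c′ * M r c′)
combineTrailingColumns-trailing n k β M r {c} n∸k≤c with n ∸ k ≤? c
... | yes _     = refl
... | no  n∸k≰c = ⊥-elim (n∸k≰c n∸k≤c)

combineTrailingColumns-suc : ∀ n k β M → k < n → (∀ c′ → n ∸ suc k < c′ → c′ < n → β (n ∸ suc k) c′ ≡ 0ℤ) →
  ∀ r c → combineTrailingColumns n (suc k) β M r c ≡
          setColumn (n ∸ suc k) (λ r → ∑ n (λ c′ → β (n ∸ suc k) c′ * combineTrailingColumns n k β M r c′))
                    (combineTrailingColumns n k β M) r c
combineTrailingColumns-suc n k β M k<n upper≡0 r c with c ≟ n ∸ suc k
... | yes refl with n ∸ suc k ≤? c
...   | no  c≰c = ⊥-elim (c≰c ℕP.≤-refl)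
...   | yes _   = ∑-cong n same-terms
  where
  same-terms : ∀ c′ → c′ < n → β c c′ * M r c′ ≡ β c c′ * combineTrailingColumns n k β M r c′
  same-terms c′ c′<n with n ∸ k ≤? c′
  ... | no  _      = refl
  ... | yes n∸k≤c′ = trans (cong (_* M r c′) β≡0) (sym (cong (_* ∑ n (λ c″ → β c′ c″ * M r c″)) β≡0))
    where
    β≡0 : β c c′ ≡ 0ℤ
    β≡0 = upper≡0 c′ (subst (_≤ c′) (m<n⇒n∸m≡1+[n∸1+m] k<n) n∸k≤c′) c′<n
combineTrailingColumns-suc n k β M k<n _ r c | no c≢j with n ∸ suc k ≤? c | n ∸ k ≤? c
... | yes _   | yes _ = refl
... | no  _   | no  _ = refl
... | yes j≤c | no  q = ⊥-elim (q (subst (_≤ c) (sym (m<n⇒n∸m≡1+[n∸1+m] k<n)) (ℕP.≤∧≢⇒< j≤c (c≢j ∘′ sym))))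
... | no  j≰c | yes q = ⊥-elim (j≰c (ℕP.≤-trans (ℕP.∸-monoʳ-≤ n (ℕP.n≤1+n k)) q))

detN-combineTrailingColumns : ∀ n k β M → k ≤ n →
  (∀ c → n ∸ k ≤ c → c < n → β c c ≡ 1ℤ) →
  (∀ c c′ → n ∸ k ≤ c → c < c′ → c′ < n → β c c′ ≡ 0ℤ) →
  detN n (combineTrailingColumns n k β M) ≡ detN n M
detN-combineTrailingColumns n zero β M _ _ _ =
  detN-cong n (λ r c _ c<n → combineTrailingColumns-leading n 0 β M r c<n)
detN-combineTrailingColumns n (suc k) β M k<n diagonal≡1 upper≡0 = begin
  detN n (combined (suc k))
    ≡⟨ detN-cong n (λ r c _ _ → combineTrailingColumns-suc n k β M k<n (λ c′ → upper≡0 j c′ ℕP.≤-refl) r c) ⟩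
  detN n (setColumn j (λ r → ∑ n (λ c′ → β j c′ * combined k r c′)) (combined k))
    ≡⟨ detN-setColumn-combination n (combined k) j (β j) j<n ⟩
  β j j * detN n (combined k)
    ≡⟨ cong (_* detN n (combined k)) (diagonal≡1 j ℕP.≤-refl j<n) ⟩
  1ℤ * detN n (combined k)
    ≡⟨ ℤP.*-identityˡ _ ⟩
  detN n (combined k)
    ≡⟨ detN-combineTrailingColumns n k β M (ℕP.<⇒≤ k<n) (λ c → diagonal≡1 c ∘′ widen) (λ c c′ → upper≡0 c c′ ∘′ widen) ⟩
  detN n M ∎
  where
  open ≡-Reasoning
  combined : ℕ → Mat
  combined k = combineTrailingColumns n k β M
  j : ℕ
  j = n ∸ suc k
  j<n : j < n
  j<n = ℕP.∸-monoʳ-< z<s k<n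
  widen : ∀ {c} → n ∸ k ≤ c → j ≤ c
  widen = ℕP.≤-trans (ℕP.∸-monoʳ-≤ n (ℕP.n≤1+n k))

-- Polynomials

shift : ℕ → Poly → Poly
shift zero    f         = f
shift (suc s) f zero    = 0ℤ
shift (suc s) f (suc e) = shift s f e

shift-+ : ∀ s f e → shift s f (s ℕ.+ e) ≡ f e
shift-+ zero    f e = refl
shift-+ (suc s) f e = shift-+ s f e

shift-< : ∀ s f {e} → e < s → shift s f e ≡ 0ℤ
shift-< (suc s) f {zero}  _         = refl
shift-< (suc s) f {suc e} (s<s e<s) = shift-< s f e<s

shift-vanishes : ∀ {deg f} → (∀ k → deg < k → f k ≡ 0ℤ) → ∀ s {e} → s ℕ.+ deg < e → shift s f e ≡ 0ℤ
shift-vanishes f-vanishes zero    deg<e                 = f-vanishes _ deg<e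
shift-vanishes f-vanishes (suc s) {suc e} (s<s s+deg<e) = shift-vanishes f-vanishes s s+deg<e

shift-isPoly : ∀ {f} → IsPoly f → ∀ s → IsPoly (shift s f)
shift-isPoly (deg , f-vanishes) s = s ℕ.+ deg , λ _ → shift-vanishes f-vanishes s

shift-∣- : ∀ {x} f g → (∀ e → x ∣ˢ f e - g e) → ∀ s e → x ∣ˢ shift s f e - shift s g e
shift-∣- f g x∣f-g zero    e       = x∣f-g e
shift-∣- f g x∣f-g (suc s) zero    = divides 0ℤ refl
shift-∣- f g x∣f-g (suc s) (suc e) = shift-∣- f g x∣f-g s e

sumTo-cong : ∀ k {f g : ℕ → ℤ} → (∀ i → i ≤ k → f i ≡ g i) → sumTo k f ≡ sumTo k g
sumTo-cong zero    f≡g = f≡g 0 z≤n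
sumTo-cong (suc k) f≡g = cong₂ _+_ (sumTo-cong k (λ i i≤k → f≡g i (ℕP.m≤n⇒m≤1+n i≤k))) (f≡g (suc k) ℕP.≤-refl)

*P-suc : ∀ A W k → (A *P W) (suc k) ≡ A (suc k) * W 0 + (A *P (λ j → W (suc j))) k
*P-suc A W k = begin
  sumTo k (λ i → A i * W (suc k ∸ i)) + A (suc k) * W (k ∸ k)
    ≡⟨ cong₂ _+_ (sumTo-cong k (λ i i≤k → cong (λ e → A i * W e) (ℕP.+-∸-assoc 1 i≤k)))
                 (cong (λ e → A (suc k) * W e) (ℕP.n∸n≡0 k)) ⟩
  sumTo k (λ i → A i * W (suc (k ∸ i))) + A (suc k) * W 0
    ≡⟨ ℤP.+-comm (sumTo k (λ i → A i * W (suc (k ∸ i)))) (A (suc k) * W 0) ⟩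
  A (suc k) * W 0 + sumTo k (λ i → A i * W (suc (k ∸ i))) ∎
  where open ≡-Reasoning

*P-shift : ∀ s A W e → (A *P shift s W) e ≡ shift s (A *P W) e
*P-shift zero    A W e       = refl
*P-shift (suc s) A W zero    = ℤP.*-zeroʳ (A 0)
*P-shift (suc s) A W (suc e) = begin
  (A *P shift (suc s) W) (suc e)             ≡⟨ *P-suc A (shift (suc s) W) e ⟩
  A (suc e) * 0ℤ + (A *P shift s W) e        ≡⟨ cong (_+ (A *P shift s W) e) (ℤP.*-zeroʳ (A (suc e))) ⟩
  0ℤ + (A *P shift s W) e                    ≡⟨ ℤP.+-identityˡ _ ⟩
  (A *P shift s W) e                         ≡⟨ *P-shift s A W e ⟩
  shift s (A *P W) e                         ∎
  where open ≡-Reasoning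

record DividesMod (x : ℤ) (A f : Poly) : Set where
  constructor dividesMod
  field
    cofactor        : Poly
    cofactor-isPoly : IsPoly cofactor
    congruence      : ∀ e → x ∣ˢ f e - (A *P cofactor) e

shift-dividesMod : ∀ {x A f} → DividesMod x A f → ∀ s → DividesMod x A (shift s f)
shift-dividesMod {x} {A} {f} (dividesMod W W-isPoly x∣f-AW) s = dividesMod (shift s W) (shift-isPoly W-isPoly s)
  (λ e → subst (λ g → x ∣ˢ shift s f e - g) (sym (*P-shift s A W e)) (shift-∣- f (A *P W) x∣f-AW s e))

sumTo-zero : ∀ k {f : ℕ → ℤ} → (∀ i → f i ≡ 0ℤ) → sumTo k f ≡ 0ℤ
sumTo-zero zero    f≡0 = f≡0 0
sumTo-zero (suc k) f≡0 = cong₂ _+_ (sumTo-zero k f≡0) (f≡0 (suc k))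

*P-zeroʳ : ∀ A {W} → (∀ k → W k ≡ 0ℤ) → ∀ e → (A *P W) e ≡ 0ℤ
*P-zeroʳ A W≡0 e = sumTo-zero e (λ i → trans (cong (A i *_) (W≡0 (e ∸ i))) (ℤP.*-zeroʳ (A i)))

*P-decompose : ∀ A W e → (A *P W) e ≡ W 0 * A e + shift 1 (A *P (λ j → W (suc j))) e
*P-decompose A W zero    = trans (ℤP.*-comm (A 0) (W 0)) (sym (ℤP.+-identityʳ _))
*P-decompose A W (suc e) = trans (*P-suc A W e) (cong (_+ (A *P (λ j → W (suc j))) e) (ℤP.*-comm (A (suc e)) (W 0)))

constP-isPoly : ∀ c → IsPoly (constP c)
constP-isPoly c = 0 , λ { (suc k) _ → refl }

sumTo-constP : ∀ c k (g : ℕ → ℤ) → sumTo k (λ i → constP c i * g i) ≡ c * g 0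
sumTo-constP c zero    g = refl
sumTo-constP c (suc k) g = trans (cong (_+ 0ℤ) (sumTo-constP c k g)) (ℤP.+-identityʳ _)

∣coefficients⇒constP∣P : ∀ {x F deg} → (∀ k → deg < k → F k ≡ 0ℤ) → (∀ k → k ≤ deg → x ∣ˢ F k) → constP x ∣P F
∣coefficients⇒constP∣P {x} {F} {deg} F-vanishes x∣F = F/x , (deg , F/x-vanishes) , F≡x*F/x
  where
  F/x : Poly
  F/x k with k ≤? deg
  ... | yes k≤deg = quotient (x∣F k k≤deg)
  ... | no  _     = 0ℤ
  F/x-vanishes : ∀ k → deg < k → F/x k ≡ 0ℤ
  F/x-vanishes k deg<k with k ≤? deg
  ... | yes k≤deg = ⊥-elim (ℕP.<⇒≱ deg<k k≤deg)
  ... | no  _     = refl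
  F[k]≡x*F/x[k] : ∀ k → F k ≡ x * F/x k
  F[k]≡x*F/x[k] k with k ≤? deg
  ... | yes k≤deg = trans (_∣ˢ_.equality (x∣F k k≤deg)) (ℤP.*-comm _ x)
  ... | no  k≰deg = trans (F-vanishes k (ℕP.≰⇒> k≰deg)) (sym (ℤP.*-zeroʳ x))
  F≡x*F/x : ∀ k → F k ≡ (constP x *P F/x) k
  F≡x*F/x k = trans (F[k]≡x*F/x[k] k) (sym (sumTo-constP x k (λ i → F/x (k ∸ i))))

-- Linear recurrences

module _ (A : Poly) (d : ℕ) where

  Recurrent : (ℕ → ℤ) → Set
  Recurrent ρ = ∀ j → ∑ (suc d) (λ i → A i * ρ (i ℕ.+ j)) ≡ 0ℤ

  Recurrent-tail : ∀ {ρ} → Recurrent ρ → Recurrent (λ e → ρ (suc e))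
  Recurrent-tail {ρ} recurrent j =
    trans (∑-cong (suc d) (λ i _ → cong (λ e → A i * ρ e) (sym (ℕP.+-suc i j)))) (recurrent (suc j))

  recurrenceFuel : (ℕ → ℤ) → ℕ → ℕ → ℤ
  recurrenceFuel init zero    e = 0ℤ
  recurrenceFuel init (suc f) e with e <? d
  ... | yes _ = init e
  ... | no  _ = - ∑ d (λ i → A i * recurrenceFuel init f (e ∸ d ℕ.+ i))

  recurrence : (ℕ → ℤ) → ℕ → ℤ
  recurrence init e = recurrenceFuel init (suc e) e

  private
    earlier : ∀ {e i} → d ≤ e → i < d → e ∸ d ℕ.+ i < e
    earlier {e} {i} d≤e i<d = subst (e ∸ d ℕ.+ i <_) (ℕP.m∸n+n≡m d≤e) (ℕP.+-monoʳ-< (e ∸ d) i<d)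

  recurrenceFuel-irrelevant : ∀ init f f′ e → e < f → e < f′ → recurrenceFuel init f e ≡ recurrenceFuel init f′ e
  recurrenceFuel-irrelevant init (suc f) (suc f′) e (s≤s e≤f) (s≤s e≤f′) with e <? d
  ... | yes _   = refl
  ... | no  e≮d = cong -_ (∑-cong d (λ i i<d → cong (A i *_)
        (recurrenceFuel-irrelevant init f f′ _ (ℕP.<-≤-trans (earlier (ℕP.≮⇒≥ e≮d) i<d) e≤f)
                                               (ℕP.<-≤-trans (earlier (ℕP.≮⇒≥ e≮d) i<d) e≤f′))))

  recurrence-initial : ∀ init e → e < d → recurrence init e ≡ init e
  recurrence-initial init e e<d with e <? d
  ... | yes _   = refl
  ... | no  e≮d = ⊥-elim (e≮d e<d)

  recurrence-recurrent : A d ≡ 1ℤ → ∀ init → Recurrent (recurrence init)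
  recurrence-recurrent A[d]≡1 init j = begin
    ∑ (suc d) (λ i → A i * ρ (i ℕ.+ j))   ≡⟨ ∑-last d (λ i → A i * ρ (i ℕ.+ j)) ⟩
    S + A d * ρ (d ℕ.+ j)                 ≡⟨ cong₂ (λ a b → S + a * b) A[d]≡1 top ⟩
    S + 1ℤ * - S                          ≡⟨ cancel S ⟩
    0ℤ                                    ∎
    where
    open ≡-Reasoning
    ρ = recurrence init
    S = ∑ d (λ i → A i * ρ (i ℕ.+ j))
    cancel : ∀ S → S + 1ℤ * - S ≡ 0ℤ
    cancel = solve-∀
    top : ρ (d ℕ.+ j) ≡ - S
    top with d ℕ.+ j <? d
    ... | yes d+j<d = ⊥-elim (ℕP.m+n≮m d j d+j<d)
    ... | no  _     = cong -_ (∑-cong d (λ i i<d → cong (A i *_) (begin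
      recurrenceFuel init (d ℕ.+ j) (d ℕ.+ j ∸ d ℕ.+ i) ≡⟨ cong (λ e → recurrenceFuel init (d ℕ.+ j) (e ℕ.+ i)) (ℕP.m+n∸m≡n d j) ⟩
      recurrenceFuel init (d ℕ.+ j) (j ℕ.+ i)          ≡⟨ cong (recurrenceFuel init (d ℕ.+ j)) (ℕP.+-comm j i) ⟩
      recurrenceFuel init (d ℕ.+ j) (i ℕ.+ j)          ≡⟨ recurrenceFuel-irrelevant init _ _ _ (ℕP.+-monoˡ-< j i<d) ℕP.≤-refl ⟩
      ρ (i ℕ.+ j)                                      ∎)))

module _ {A : Poly} {d : ℕ} (A-vanishes : ∀ k → d < k → A k ≡ 0ℤ) where

  ∑-A*ρ≡0 : ∀ {ρ} → Recurrent A d ρ → ∀ B → d < B → ∑ B (λ e → A e * ρ e) ≡ 0ℤ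
  ∑-A*ρ≡0 {ρ} recurrent B d<B = begin
    ∑ B (λ e → A e * ρ e)                     ≡⟨ cong (λ B → ∑ B (λ e → A e * ρ e)) (ℕP.m+[n∸m]≡n d<B) ⟨
    ∑ (suc d ℕ.+ (B ∸ suc d)) (λ e → A e * ρ e) ≡⟨ ∑-extend (suc d) (B ∸ suc d) _ (λ e d<e → cong (_* ρ e) (A-vanishes e d<e)) ⟩
    ∑ (suc d) (λ e → A e * ρ e)               ≡⟨ ∑-cong (suc d) (λ i _ → cong (λ e → A i * ρ e) (ℕP.+-identityʳ i)) ⟨
    ∑ (suc d) (λ i → A i * ρ (i ℕ.+ 0))       ≡⟨ recurrent 0 ⟩
    0ℤ                                        ∎
    where open ≡-Reasoning

  ∑-[A*W]*ρ≡0 : ∀ w W → (∀ k → w ≤ k → W k ≡ 0ℤ) → ∀ {ρ} → Recurrent A d ρ → ∀ B → w ℕ.+ d ≤ B →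
    ∑ B (λ e → (A *P W) e * ρ e) ≡ 0ℤ
  ∑-[A*W]*ρ≡0 zero    W W-vanishes _ B _ =
    ∑-zero B (λ e _ → cong (_* _) (*P-zeroʳ A (λ k → W-vanishes k z≤n) e))
  ∑-[A*W]*ρ≡0 (suc w) W W-vanishes {ρ} recurrent (suc B) (s≤s w+d≤B) = begin
    ∑ (suc B) (λ e → (A *P W) e * ρ e)
      ≡⟨ ∑-cong (suc B) (λ e _ → trans (cong (_* ρ e) (*P-decompose A W e)) (distribute (W 0) (A e) _ (ρ e))) ⟩
    ∑ (suc B) (λ e → W 0 * (A e * ρ e) + shift 1 (A *P W′) e * ρ e)
      ≡⟨ ∑-+ (suc B) (λ e → W 0 * (A e * ρ e)) (λ e → shift 1 (A *P W′) e * ρ e) ⟩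
    ∑ (suc B) (λ e → W 0 * (A e * ρ e)) + (0ℤ + ∑ B (λ e → (A *P W′) e * ρ (suc e)))
      ≡⟨ cong₂ (λ a b → a + (0ℤ + b)) (∑-*ˡ (suc B) (W 0) (λ e → A e * ρ e))
               (∑-[A*W]*ρ≡0 w W′ (λ k w≤k → W-vanishes (suc k) (s≤s w≤k)) (Recurrent-tail A d recurrent) B w+d≤B) ⟩
    W 0 * ∑ (suc B) (λ e → A e * ρ e) + 0ℤ
      ≡⟨ cong (λ a → W 0 * a + 0ℤ) (∑-A*ρ≡0 recurrent (suc B) (s≤s (ℕP.≤-trans (ℕP.m≤n+m d w) w+d≤B))) ⟩
    W 0 * 0ℤ + 0ℤ
      ≡⟨ cong (_+ 0ℤ) (ℤP.*-zeroʳ (W 0)) ⟩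
    0ℤ ∎
    where
    open ≡-Reasoning
    W′ : Poly
    W′ j = W (suc j)
    distribute : ∀ w a t r → (w * a + t) * r ≡ w * (a * r) + t * r
    distribute = solve-∀

  dividesMod⇒∣∑ : ∀ {x f ρ} → DividesMod x A f → Recurrent A d ρ → ∀ B → (∀ e → B ≤ e → f e ≡ 0ℤ) →
    x ∣ˢ ∑ B (λ e → f e * ρ e)
  dividesMod⇒∣∑ {x} {f} {ρ} (dividesMod W (w , W-vanishes) x∣f-AW) recurrent B f-vanishes =
    subst (x ∣ˢ_) pairing≡ (∣⇒∣∑ B′ _ (λ e _ → ∣m⇒∣m*n (ρ e) (x∣f-AW e)))
    where
    open ≡-Reasoning
    B′ = B ℕ.+ (suc w ℕ.+ d)
    split : ∀ f g r → f * r ≡ (f - g) * r + g * r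
    split = solve-∀
    pairing≡ : ∑ B′ (λ e → (f e - (A *P W) e) * ρ e) ≡ ∑ B (λ e → f e * ρ e)
    pairing≡ = begin
      ∑ B′ (λ e → (f e - (A *P W) e) * ρ e)
        ≡⟨ ℤP.+-identityʳ _ ⟨
      ∑ B′ (λ e → (f e - (A *P W) e) * ρ e) + 0ℤ
        ≡⟨ cong (_+_ (∑ B′ (λ e → (f e - (A *P W) e) * ρ e))) (∑-[A*W]*ρ≡0 (suc w) W W-vanishes recurrent B′ (ℕP.m≤n+m _ B)) ⟨
      ∑ B′ (λ e → (f e - (A *P W) e) * ρ e) + ∑ B′ (λ e → (A *P W) e * ρ e)
        ≡⟨ ∑-+ B′ (λ e → (f e - (A *P W) e) * ρ e) (λ e → (A *P W) e * ρ e) ⟨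
      ∑ B′ (λ e → (f e - (A *P W) e) * ρ e + (A *P W) e * ρ e)
        ≡⟨ ∑-cong B′ (λ e _ → split (f e) ((A *P W) e) (ρ e)) ⟨
      ∑ B′ (λ e → f e * ρ e)
        ≡⟨ ∑-extend B (suc w ℕ.+ d) _ (λ e B≤e → cong (_* ρ e) (f-vanishes e B≤e)) ⟩
      ∑ B (λ e → f e * ρ e) ∎

δ : ℕ → ℕ → ℤ
δ t e with e ≟ t
... | yes _ = 1ℤ
... | no  _ = 0ℤ

δ-same : ∀ t → δ t t ≡ 1ℤ
δ-same t with t ≟ t
... | yes _   = refl
... | no  t≢t = ⊥-elim (t≢t refl)

δ-other : ∀ t {e} → e ≢ t → δ t e ≡ 0ℤ
δ-other t {e} e≢t with e ≟ t
... | yes e≡t = ⊥-elim (e≢t e≡t)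
... | no  _   = refl

-- dualBasis A d t e is the coefficient of X^t in the remainder of X^e modulo the monic A.
dualBasis : Poly → ℕ → ℕ → ℕ → ℤ
dualBasis A d t = recurrence A d (δ t)

module _ {A : Poly} {d : ℕ} (A-monic : Monic A d) where

  dualBasis-recurrent : ∀ t → Recurrent A d (dualBasis A d t)
  dualBasis-recurrent t = recurrence-recurrent A d (proj₁ A-monic) (δ t)

  dualBasis-diagonal : ∀ {t} → t < d → dualBasis A d t t ≡ 1ℤ
  dualBasis-diagonal {t} t<d = trans (recurrence-initial A d (δ t) t t<d) (δ-same t)

  dualBasis-offDiagonal : ∀ t {e} → e < d → e ≢ t → dualBasis A d t e ≡ 0ℤ
  dualBasis-offDiagonal t {e} e<d e≢t = trans (recurrence-initial A d (δ t) e e<d) (δ-other t e≢t)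

  lowDegree-dividesMod⇒∣ : ∀ {x f deg} → DividesMod x A f → (∀ k → deg < k → f k ≡ 0ℤ) → deg < d →
    ∀ k → k ≤ deg → x ∣ˢ f k
  lowDegree-dividesMod⇒∣ {x} {f} {deg} A∣f f-vanishes deg<d k k≤deg =
    subst (x ∣ˢ_) pairing≡f[k] (dividesMod⇒∣∑ (proj₂ A-monic) A∣f (dualBasis-recurrent k) (suc deg) f-vanishes)
    where
    ρ = dualBasis A d k
    pairing≡f[k] : ∑ (suc deg) (λ e → f e * ρ e) ≡ f k
    pairing≡f[k] = begin
      ∑ (suc deg) (λ e → f e * ρ e)  ≡⟨ ∑-select (suc deg) k _ (s≤s k≤deg) (λ e e≤deg e≢k →
                                          trans (cong (f e *_) (dualBasis-offDiagonal k (ℕP.<-≤-trans e≤deg deg<d) e≢k)) (ℤP.*-zeroʳ (f e))) ⟩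
      f k * ρ k                      ≡⟨ cong (f k *_) (dualBasis-diagonal (ℕP.≤-<-trans k≤deg deg<d)) ⟩
      f k * 1ℤ                       ≡⟨ ℤP.*-identityʳ (f k) ⟩
      f k                            ∎
      where open ≡-Reasoning

constP-nonUnit : ∀ {N} → 2 ≤ N →
  (∀ k → constP (+ N) k ≡ constP (+ 1) k) ⊎ (∀ k → constP (+ N) k ≡ constP (- + 1) k) → ⊥
constP-nonUnit 2≤N (inj₁ N≡1)  = ℕP.<-irrefl (sym (ℤP.+-injective (N≡1 0))) 2≤N
constP-nonUnit 2≤N (inj₂ N≡-1) with N≡-1 0
... | ()

¬commonFactorMod-aboveDegrees : ∀ {P Q m n N A d} → (∀ k → m < k → P k ≡ 0ℤ) → (∀ k → n < k → Q k ≡ 0ℤ) →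
  CoprimeP P Q → 2 ≤ N → Monic A d → DividesMod (+ N) A P → DividesMod (+ N) A Q → m < d → n < d → ⊥
¬commonFactorMod-aboveDegrees {N = N} P-vanishes Q-vanishes coprime 2≤N A-monic A∣P A∣Q m<d n<d =
  constP-nonUnit 2≤N (coprime (constP (+ N)) (constP-isPoly (+ N))
    (∣coefficients⇒constP∣P P-vanishes (lowDegree-dividesMod⇒∣ A-monic A∣P P-vanishes m<d))
    (∣coefficients⇒constP∣P Q-vanishes (lowDegree-dividesMod⇒∣ A-monic A∣Q Q-vanishes n<d)))

-- The Sylvester matrix

band≡shift : ∀ {deg f} → (∀ k → deg < k → f k ≡ 0ℤ) → ∀ i s c e → i ℕ.+ s ℕ.+ deg ≡ c ℕ.+ e →
  band f deg i c ≡ shift s f e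
band≡shift {deg} {f} f-vanishes i s c e i+s+deg≡c+e with i ℕ.≤ᵇ c in i≤ᵇc | c ℕ.≤ᵇ i ℕ.+ deg in c≤ᵇi+deg
... | false | _     = sym (shift-vanishes f-vanishes s (ℕP.+-cancelˡ-< c (s ℕ.+ deg) e (begin-strict
  c ℕ.+ (s ℕ.+ deg)  <⟨ ℕP.+-monoˡ-< (s ℕ.+ deg) c<i ⟩
  i ℕ.+ (s ℕ.+ deg)  ≡⟨ ℕP.+-assoc i s deg ⟨
  i ℕ.+ s ℕ.+ deg    ≡⟨ i+s+deg≡c+e ⟩
  c ℕ.+ e            ∎)))
  where
  open ℕP.≤-Reasoning
  c<i : c < i
  c<i = ℕP.≰⇒> (λ i≤c → subst T i≤ᵇc (ℕP.≤⇒≤ᵇ i≤c))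
... | true  | false = sym (shift-< s f (ℕP.+-cancelˡ-< (i ℕ.+ deg) e s (begin-strict
  i ℕ.+ deg ℕ.+ e    <⟨ ℕP.+-monoˡ-< e i+deg<c ⟩
  c ℕ.+ e            ≡⟨ i+s+deg≡c+e ⟨
  i ℕ.+ s ℕ.+ deg    ≡⟨ reorder i s deg ⟩
  i ℕ.+ deg ℕ.+ s    ∎)))
  where
  open ℕP.≤-Reasoning
  i+deg<c : i ℕ.+ deg < c
  i+deg<c = ℕP.≰⇒> (λ c≤i+deg → subst T c≤ᵇi+deg (ℕP.≤⇒≤ᵇ c≤i+deg))
  reorder : ∀ i s deg → i ℕ.+ s ℕ.+ deg ≡ i ℕ.+ deg ℕ.+ s
  reorder = ℕSolver.solve-∀
... | true  | true  = sym (trans (cong (shift s f) e≡s+[deg+i∸c]) (shift-+ s f (deg ℕ.+ i ∸ c)))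
  where
  open ≡-Reasoning
  c≤deg+i : c ≤ deg ℕ.+ i
  c≤deg+i = subst (c ≤_) (ℕP.+-comm i deg) (ℕP.≤ᵇ⇒≤ c (i ℕ.+ deg) (subst T (sym c≤ᵇi+deg) tt))
  reorder : ∀ i s deg → i ℕ.+ s ℕ.+ deg ≡ s ℕ.+ (deg ℕ.+ i)
  reorder = ℕSolver.solve-∀
  swap-front : ∀ s c t → s ℕ.+ (c ℕ.+ t) ≡ c ℕ.+ (s ℕ.+ t)
  swap-front = ℕSolver.solve-∀
  e≡s+[deg+i∸c] : e ≡ s ℕ.+ (deg ℕ.+ i ∸ c)
  e≡s+[deg+i∸c] = ℕP.+-cancelˡ-≡ c e _ (begin
    c ℕ.+ e                          ≡⟨ i+s+deg≡c+e ⟨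
    i ℕ.+ s ℕ.+ deg                  ≡⟨ reorder i s deg ⟩
    s ℕ.+ (deg ℕ.+ i)                ≡⟨ cong (s ℕ.+_) (ℕP.m+[n∸m]≡n c≤deg+i) ⟨
    s ℕ.+ (c ℕ.+ (deg ℕ.+ i ∸ c))    ≡⟨ swap-front s c _ ⟩
    c ℕ.+ (s ℕ.+ (deg ℕ.+ i ∸ c))    ∎)

module SylvesterRows {P Q : Poly} {m n : ℕ}
  (P-vanishes : ∀ k → m < k → P k ≡ 0ℤ) (Q-vanishes : ∀ k → n < k → Q k ≡ 0ℤ) where

  row : ℕ → Poly
  row r with r <? n
  ... | yes _ = shift (n ∸ suc r) P
  ... | no  _ = shift (m ∸ suc (r ∸ n)) Q

  row-upper : ∀ {r} → r < n → ∀ e → row r e ≡ shift (n ∸ suc r) P e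
  row-upper {r} r<n e with r <? n
  ... | yes _   = refl
  ... | no  r≮n = ⊥-elim (r≮n r<n)

  row-lower : ∀ {r} → n ≤ r → ∀ e → row r e ≡ shift (m ∸ suc (r ∸ n)) Q e
  row-lower {r} n≤r e with r <? n
  ... | yes r<n = ⊥-elim (ℕP.<⇒≱ r<n n≤r)
  ... | no  _   = refl

  row-dividesMod : ∀ {x A} → DividesMod x A P → DividesMod x A Q → ∀ r → DividesMod x A (row r)
  row-dividesMod A∣P A∣Q r with r <? n
  ... | yes _ = shift-dividesMod A∣P (n ∸ suc r)
  ... | no  _ = shift-dividesMod A∣Q (m ∸ suc (r ∸ n))

  row-vanishes : ∀ {r e} → r < n ℕ.+ m → n ℕ.+ m ≤ e → row r e ≡ 0ℤ
  row-vanishes {r} {e} r<n+m n+m≤e with r <? n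
  ... | yes r<n = shift-vanishes P-vanishes (n ∸ suc r) (ℕP.<-≤-trans (ℕP.+-monoˡ-< m (ℕP.∸-monoʳ-< z<s r<n)) n+m≤e)
  ... | no  r≮n = shift-vanishes Q-vanishes (m ∸ suc (r ∸ n))
        (ℕP.<-≤-trans (subst (m ∸ suc (r ∸ n) ℕ.+ n <_) (ℕP.+-comm m n) (ℕP.+-monoˡ-< n (ℕP.∸-monoʳ-< z<s r∸n<m))) n+m≤e)
    where
    r∸n<m : r ∸ n < m
    r∸n<m = ℕP.+-cancelˡ-< n (r ∸ n) m (subst (_< n ℕ.+ m) (sym (ℕP.m+[n∸m]≡n (ℕP.≮⇒≥ r≮n))) r<n+m)

  sylvester≡row : ∀ ri ci → sylvester P Q m n ri ci ≡ row (toℕ ri) (n ℕ.+ m ∸ suc (toℕ ci))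
  sylvester≡row ri ci with splitAt n ri in split≡
  ... | inj₁ i = begin
    band P m (toℕ i) c       ≡⟨ cong (λ i → band P m i c) r≡i ⟨
    band P m r c             ≡⟨ band≡shift P-vanishes r (n ∸ suc r) c e (ℕP.suc-injective
                                  (trans (cong (ℕ._+ m) (ℕP.m+[n∸m]≡n r<n)) (sym 1+c+e≡n+m))) ⟩
    shift (n ∸ suc r) P e    ≡⟨ row-upper r<n e ⟨
    row r e                  ∎
    where
    open ≡-Reasoning
    r = toℕ ri
    c = toℕ ci
    e = n ℕ.+ m ∸ suc c
    1+c+e≡n+m : suc (c ℕ.+ e) ≡ n ℕ.+ m
    1+c+e≡n+m = ℕP.m+[n∸m]≡n (FinP.toℕ<n ci)
    r≡i : r ≡ toℕ i
    r≡i = trans (cong toℕ (sym (FinP.splitAt⁻¹-↑ˡ split≡))) (FinP.toℕ-↑ˡ i m)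
    r<n : r < n
    r<n = subst (_< n) (sym r≡i) (FinP.toℕ<n i)
  ... | inj₂ i = begin
    band Q n (toℕ i) c              ≡⟨ cong (λ i → band Q n i c) r∸n≡i ⟨
    band Q n (r ∸ n) c              ≡⟨ band≡shift Q-vanishes (r ∸ n) (m ∸ suc (r ∸ n)) c e (ℕP.suc-injective
                                         (trans (cong (ℕ._+ n) (ℕP.m+[n∸m]≡n r∸n<m)) (trans (ℕP.+-comm m n) (sym 1+c+e≡n+m)))) ⟩
    shift (m ∸ suc (r ∸ n)) Q e     ≡⟨ row-lower n≤r e ⟨
    row r e                         ∎
    where
    open ≡-Reasoning
    r = toℕ ri
    c = toℕ ci
    e = n ℕ.+ m ∸ suc c
    1+c+e≡n+m : suc (c ℕ.+ e) ≡ n ℕ.+ m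
    1+c+e≡n+m = ℕP.m+[n∸m]≡n (FinP.toℕ<n ci)
    r≡n+i : r ≡ n ℕ.+ toℕ i
    r≡n+i = trans (cong toℕ (sym (FinP.splitAt⁻¹-↑ʳ split≡))) (FinP.toℕ-↑ʳ n i)
    n≤r : n ≤ r
    n≤r = subst (n ≤_) (sym r≡n+i) (ℕP.m≤m+n n (toℕ i))
    r∸n≡i : r ∸ n ≡ toℕ i
    r∸n≡i = trans (cong (_∸ n) r≡n+i) (ℕP.m+n∸m≡n n (toℕ i))
    r∸n<m : r ∸ n < m
    r∸n<m = subst (_< m) (sym r∸n≡i) (FinP.toℕ<n i)

  sylvesterℕ : Mat
  sylvesterℕ r c = row r (n ℕ.+ m ∸ suc c)

  resultant≡detN : resultant P Q m n ≡ detN (n ℕ.+ m) sylvesterℕ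
  resultant≡detN = det≡detN (n ℕ.+ m) (sylvester P Q m n) sylvesterℕ sylvester≡row

resultant-divisible : ∀ {P Q m n x A d} → (∀ k → m < k → P k ≡ 0ℤ) → (∀ k → n < k → Q k ≡ 0ℤ) →
  Monic A d → DividesMod x A P → DividesMod x A Q → d ≤ n ℕ.+ m → x ℤ.^ d ∣ˢ resultant P Q m n
resultant-divisible {P} {Q} {m} {n} {x} {A} {d} P-vanishes Q-vanishes A-monic A∣P A∣Q d≤K =
  subst (x ℤ.^ d ∣ˢ_) (trans (detN-combineTrailingColumns K d β sylvesterℕ d≤K β-diagonal β-upper) (sym resultant≡detN))
        (detN-trailingColumnsDivisible K x d (combineTrailingColumns K d β sylvesterℕ) d≤K trailing-divisible)
  where
  open SylvesterRows P-vanishes Q-vanishes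
  K = n ℕ.+ m
  β : ℕ → ℕ → ℤ
  β c c′ = dualBasis A d (K ∸ suc c) (K ∸ suc c′)
  exponent<d : ∀ {c} → K ∸ d ≤ c → c < K → K ∸ suc c < d
  exponent<d {c} K∸d≤c c<K = ℕP.<-≤-trans (ℕP.∸-monoʳ-< (ℕP.n<1+n c) c<K)
                                         (subst (K ∸ c ≤_) (ℕP.m∸[m∸n]≡n d≤K) (ℕP.∸-monoʳ-≤ K K∸d≤c))
  β-diagonal : ∀ c → K ∸ d ≤ c → c < K → β c c ≡ 1ℤ
  β-diagonal c K∸d≤c c<K = dualBasis-diagonal A-monic (exponent<d K∸d≤c c<K)
  β-upper : ∀ c c′ → K ∸ d ≤ c → c < c′ → c′ < K → β c c′ ≡ 0ℤ
  β-upper c c′ K∸d≤c c<c′ c′<K =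
    dualBasis-offDiagonal A-monic _ (ℕP.<-trans e′<e (exponent<d K∸d≤c (ℕP.<-trans c<c′ c′<K))) (ℕP.<⇒≢ e′<e)
    where
    e′<e : K ∸ suc c′ < K ∸ suc c
    e′<e = ℕP.∸-monoʳ-< (s<s c<c′) c′<K
  trailing-divisible : ∀ r c → r < K → K ∸ d ≤ c → c < K → x ∣ˢ combineTrailingColumns K d β sylvesterℕ r c
  trailing-divisible r c r<K K∸d≤c _ = subst (x ∣ˢ_) (sym entry≡pairing)
    (dividesMod⇒∣∑ (proj₂ A-monic) (row-dividesMod A∣P A∣Q r) (dualBasis-recurrent A-monic t) K (λ _ → row-vanishes r<K))
    where
    open ≡-Reasoning
    t = K ∸ suc c
    entry≡pairing : combineTrailingColumns K d β sylvesterℕ r c ≡ ∑ K (λ e → row r e * dualBasis A d t e)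
    entry≡pairing = begin
      combineTrailingColumns K d β sylvesterℕ r c      ≡⟨ combineTrailingColumns-trailing K d β sylvesterℕ r K∸d≤c ⟩
      ∑ K (λ c′ → β c c′ * sylvesterℕ r c′)            ≡⟨ ∑-cong K (λ c′ _ → ℤP.*-comm (β c c′) (sylvesterℕ r c′)) ⟩
      ∑ K (λ c′ → sylvesterℕ r c′ * β c c′)            ≡⟨ ∑-reverse K (λ e → row r e * dualBasis A d t e) ⟩
      ∑ K (λ e → row r e * dualBasis A d t e)          ∎

dividesModN⇒dividesMod : ∀ {N A f} → DividesModN N A f → DividesMod (+ N) A f
dividesModN⇒dividesMod (W , W-isPoly , N∣f-AW) = dividesMod W W-isPoly (λ e → ∣ᵤ⇒∣ (N∣f-AW e))

+-^ : ∀ N d → (+ N) ℤ.^ d ≡ + (N ^ d)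
+-^ N zero    = refl
+-^ N (suc d) = trans (cong (+ N *_) (+-^ N d)) (sym (ℤP.pos-* N (N ^ d)))

lemma28 : (P Q : Poly) (m n : ℕ) → HasDegree P m → HasDegree Q n → 1 ≤ m → 1 ≤ n →
          CoprimeP P Q → (N : ℕ) → 2 ≤ N → (A : Poly) (d : ℕ) → 1 ≤ d → Monic A d →
          DividesModN N A P → DividesModN N A Q →
          (+ (N ^ d)) ∣ resultant P Q m n
lemma28 P Q m n P-degree Q-degree _ _ coprime N 2≤N A d _ A-monic A∣P A∣Q with d ≤? n ℕ.+ m
... | yes d≤n+m = ∣⇒∣ᵤ (subst (_∣ˢ resultant P Q m n) (+-^ N d)
      (resultant-divisible (proj₂ P-degree) (proj₂ Q-degree) A-monic
                           (dividesModN⇒dividesMod A∣P) (dividesModN⇒dividesMod A∣Q) d≤n+m))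
... | no  d≰n+m = ⊥-elim (¬commonFactorMod-aboveDegrees (proj₂ P-degree) (proj₂ Q-degree) coprime 2≤N A-monic
      (dividesModN⇒dividesMod A∣P) (dividesModN⇒dividesMod A∣Q)
      (ℕP.≤-<-trans (ℕP.m≤n+m m n) n+m<d) (ℕP.≤-<-trans (ℕP.m≤m+n n m) n+m<d))
  where
  n+m<d : n ℕ.+ m < d
  n+m<d = ℕP.≰⇒> d≰n+m
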